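{- Let $1\leq c_0<c_1<\cdots<c_m=x$ be natural numbers such that for every $j\in\{0,\ldots,m-1\}$ the quotient $c_{j+1}/c_j$ is an integer greater than or equal to $2$. Then $$\prod_{j=0}^{m-1} 2^{\,d_{c_{j+1}/c_j}\cdot \frac{x}{c_j}}\ \leq\ 2^{1.54\frac{x}{c_0}} .$$
   Context: Let $I=\{2,3,4,5,6,7,8,9,10,11,12,13,15,16,23,24\}$. The numbers $d_n$ ($n\geq 2$) are defined by: $d_2=1/2$, $d_3=0.8617$, $d_4=1.1463$, $d_5=0.8644$, $d_6=1.1512$, $d_7=1.0561$, $d_8=1.2991$, $d_9=1.1736$, $d_{10}=1.0492$, $d_{11}=1.1774$, $d_{12}=1.3781$, $d_{13}=0.9582$, $d_{15}=0.9533$, $d_{16}=1.1438$, $d_{23}=1.0123$, $d_{24}=1.1612$, and $d_n=1$ for $n\notin I$. -}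

module Defs where

open import Data.Nat using (ℕ; zero; suc; _≡ᵇ_)
open import Data.Bool using (if_then_else_)
open import Data.Fin using (Fin; zero; suc)
open import Data.Integer using (+_)
open import Data.Rational using (ℚ; _/_; _+_; 0ℚ; 1ℚ)

-- n / k as a rational number; the k = 0 case is a junk value that never
-- arises in the statement (all c_j ≥ 1).
frac : ℕ → ℕ → ℚ
frac n zero    = 0ℚ
frac n (suc k) = (+ n) / suc k

d : ℕ → ℚ
d n =
  if n ≡ᵇ 2 then frac 1 2 else
  if n ≡ᵇ 3 then frac 8617 10000 else
  if n ≡ᵇ 4 then frac 11463 10000 else
  if n ≡ᵇ 5 then frac 8644 10000 else
  if n ≡ᵇ 6 then frac 11512 10000 else
  if n ≡ᵇ 7 then frac 10561 10000 else
  if n ≡ᵇ 8 then frac 12991 10000 else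
  if n ≡ᵇ 9 then frac 11736 10000 else
  if n ≡ᵇ 10 then frac 10492 10000 else
  if n ≡ᵇ 11 then frac 11774 10000 else
  if n ≡ᵇ 12 then frac 13781 10000 else
  if n ≡ᵇ 13 then frac 9582 10000 else
  if n ≡ᵇ 15 then frac 9533 10000 else
  if n ≡ᵇ 16 then frac 11438 10000 else
  if n ≡ᵇ 23 then frac 10123 10000 else
  if n ≡ᵇ 24 then frac 11612 10000 else
  1ℚ

sumℚ : ∀ {m} → (Fin m → ℚ) → ℚ
sumℚ {zero}  f = 0ℚ
sumℚ {suc m} f = f zero + sumℚ (λ j → f (suc j))

-- Write y_j = x / c_j, so that y_j = q_j y_(j+1). Every d_q satisfies d_q ≤ 1.54 (1 - 1/q) for
-- q ≥ 2 (checked by evaluation for q < 25, immediate from d_q = 1 beyond), and this is exactly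
-- d_(q_j) y_j + 1.54 y_(j+1) ≤ 1.54 y_j. Chaining these inequalities from the top of the divisor
-- chain down bounds the whole sum by 1.54 y_0.
module Submission where

open import Defs
open import Data.Nat using (ℕ; suc; _≤_; _<_; _*_; pred; _≤?_; _<?_; allUpTo?)
import Data.Nat.Properties as ℕ
open import Data.Fin using (Fin; zero; suc; inject₁; fromℕ)
open import Data.Integer using (+_)
import Data.Integer as ℤ
import Data.Integer.Properties as ℤ
open import Data.Rational using (ℚ; 1ℚ; NonNegative; toℚᵘ)
  renaming (_+_ to _+ℚ_; _*_ to _*ℚ_; _≤_ to _≤ℚ_; _≤?_ to _≤ℚ?_)
open import Data.Rational.Properties
  using ( ≤-refl; ≤-trans; module ≤-Reasoning; ≤ᵇ⇒≤; toℚᵘ-injective; toℚᵘ-fromℚᵘ; toℚᵘ-cancel-≤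
        ; toℚᵘ-homo-*; normalize-nonNeg; nonNegative⁻¹; nonNeg*nonNeg⇒nonNeg
        ; *-assoc; *-distribʳ-+; +-monoʳ-≤; *-monoʳ-≤-nonNeg; *-monoˡ-≤-nonNeg )
open import Data.Rational.Unnormalised using (mkℚᵘ; *≡*; *≤*)
  renaming (_≃_ to _≃ᵘ_; _*_ to _*ᵘ_)
import Data.Rational.Unnormalised.Properties as ℚᵘ
open import Data.Unit using (tt)
open import Data.Product using (proj₂)
open import Function using (_∘_)
open import Relation.Binary.PropositionalEquality
  using (_≡_; refl; sym; cong; subst; module ≡-Reasoning)
open import Relation.Nullary.Decidable using (Dec; yes; no; _→-dec_; toWitness)

toℚᵘ-frac : ∀ n k → toℚᵘ (frac n (suc k)) ≃ᵘ mkℚᵘ (+ n) k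
toℚᵘ-frac n k = toℚᵘ-fromℚᵘ (mkℚᵘ (+ n) k)

frac-nonNeg : ∀ n k → NonNegative (frac n k)
frac-nonNeg n 0       = _
frac-nonNeg n (suc k) = normalize-nonNeg n (suc k)

frac-monoˡ-≤ : ∀ k {m n} → m ≤ n → frac m k ≤ℚ frac n k
frac-monoˡ-≤ 0       _   = ≤-refl
frac-monoˡ-≤ (suc k) {m} {n} m≤n = toℚᵘ-cancel-≤ (begin
  toℚᵘ (frac m (suc k)) ≃⟨ toℚᵘ-frac m k ⟩
  mkℚᵘ (+ m) k          ≤⟨ *≤* (ℤ.*-monoʳ-≤-nonNeg (+ suc k) (ℤ.+≤+ m≤n)) ⟩
  mkℚᵘ (+ n) k          ≃⟨ toℚᵘ-frac n k ⟨
  toℚᵘ (frac n (suc k)) ∎)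
  where open ℚᵘ.≤-Reasoning

mkℚᵘ-scale-denominator : ∀ x q c →
  mkℚᵘ (+ x) c ≃ᵘ mkℚᵘ (+ suc q) 0 *ᵘ mkℚᵘ (+ x) (pred (suc q * suc c))
mkℚᵘ-scale-denominator x q c = *≡* (begin
  X ℤ.* + (1 * (suc q * suc c)) ≡⟨ cong (λ n → X ℤ.* + n) (ℕ.*-identityˡ (suc q * suc c)) ⟩
  X ℤ.* + (suc q * suc c)       ≡⟨ cong (X ℤ.*_) (ℤ.pos-* (suc q) (suc c)) ⟩
  X ℤ.* (Q ℤ.* C)               ≡⟨ ℤ.*-assoc X Q C ⟨
  X ℤ.* Q ℤ.* C                 ≡⟨ cong (ℤ._* C) (ℤ.*-comm X Q) ⟩
  Q ℤ.* X ℤ.* C                 ∎)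
  where
  open ≡-Reasoning
  X = + x
  Q = + suc q
  C = + suc c

frac-scale-denominator : ∀ x {q c} → 1 ≤ q → 1 ≤ c → frac x c ≡ frac q 1 *ℚ frac x (q * c)
frac-scale-denominator x {suc q} {suc c} _ _ = toℚᵘ-injective (begin
  toℚᵘ (frac x (suc c))               ≈⟨ toℚᵘ-frac x c ⟩
  mkℚᵘ (+ x) c                        ≈⟨ mkℚᵘ-scale-denominator x q c ⟩
  mkℚᵘ (+ suc q) 0 *ᵘ mkℚᵘ (+ x) qc-1  ≈⟨ ℚᵘ.*-cong (toℚᵘ-frac (suc q) 0) (toℚᵘ-frac x qc-1) ⟨
  toℚᵘ (frac (suc q) 1) *ᵘ toℚᵘ z      ≈⟨ toℚᵘ-homo-* (frac (suc q) 1) z ⟨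
  toℚᵘ (frac (suc q) 1 *ℚ z)          ∎)
  where
  open ℚᵘ.≃-Reasoning
  qc-1 = pred (suc q * suc c)
  z = frac x (suc q * suc c)

absorb-step : ∀ {w a r y z} .{{_ : NonNegative z}} → y ≡ r *ℚ z →
  w *ℚ r +ℚ a ≤ℚ a *ℚ r → w *ℚ y +ℚ a *ℚ z ≤ℚ a *ℚ y
absorb-step {w} {a} {r} {z = z} refl wr+a≤ar = begin
  w *ℚ (r *ℚ z) +ℚ a *ℚ z ≡⟨ cong (_+ℚ a *ℚ z) (*-assoc w r z) ⟨
  w *ℚ r *ℚ z +ℚ a *ℚ z   ≡⟨ *-distribʳ-+ z (w *ℚ r) a ⟨
  (w *ℚ r +ℚ a) *ℚ z      ≤⟨ *-monoʳ-≤-nonNeg z wr+a≤ar ⟩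
  a *ℚ r *ℚ z             ≡⟨ *-assoc a r z ⟩
  a *ℚ (r *ℚ z)           ∎
  where open ≤-Reasoning

-- δ ≤ a (1 - 1/q), with the denominator cleared.
StepBound : ℚ → ℚ → ℕ → Set
StepBound a δ q = δ *ℚ frac q 1 +ℚ a ≤ℚ a *ℚ frac q 1

stepBound? : ∀ a δ q → Dec (StepBound a δ q)
stepBound? a δ q = δ *ℚ frac q 1 +ℚ a ≤ℚ? a *ℚ frac q 1

module _ (w : ℕ → ℚ) (a : ℚ) .{{_ : NonNegative a}}
         (w-bound : ∀ q → 2 ≤ q → StepBound a (w q) q) where

  divisor-chain-sum-≤ : ∀ m (c : Fin (suc m) → ℕ) (q : Fin m → ℕ) → 1 ≤ c zero →
    (∀ j → c (suc j) ≡ q j * c (inject₁ j)) → (∀ j → 2 ≤ q j) →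
    sumℚ (λ j → w (q j) *ℚ frac (c (fromℕ m)) (c (inject₁ j))) ≤ℚ a *ℚ frac (c (fromℕ m)) (c zero)
  divisor-chain-sum-≤ 0 c q c₀≥1 _ _ =
    nonNegative⁻¹ (a *ℚ y) {{nonNeg*nonNeg⇒nonNeg a y {{frac-nonNeg (c zero) (c zero)}}}}
    where y = frac (c zero) (c zero)
  divisor-chain-sum-≤ (suc m) c q c₀≥1 c-step q≥2 =
    ≤-trans (+-monoʳ-≤ (w (q zero) *ℚ frac x (c zero)) rest≤)
            (absorb-step {w (q zero)} {a} {frac (q zero) 1} {z = z} {{frac-nonNeg x (q zero * c zero)}}
              (frac-scale-denominator x q₀≥1 c₀≥1) (w-bound (q zero) (q≥2 zero)))
    where
    x = c (fromℕ (suc m))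
    z = frac x (q zero * c zero)
    q₀≥1 : 1 ≤ q zero
    q₀≥1 = ℕ.<⇒≤ (q≥2 zero)
    c₁≥1 : 1 ≤ c (suc zero)
    c₁≥1 = subst (1 ≤_) (sym (c-step zero)) (ℕ.*-mono-≤ q₀≥1 c₀≥1)
    rest = sumℚ (λ j → w (q (suc j)) *ℚ frac x (c (suc (inject₁ j))))
    rest≤ : rest ≤ℚ a *ℚ z
    rest≤ = subst (λ c₁ → rest ≤ℚ a *ℚ frac x c₁) (c-step zero)
      (divisor-chain-sum-≤ m (c ∘ suc) (q ∘ suc) c₁≥1 (c-step ∘ suc) (q≥2 ∘ suc))

n+154/100≤154/100*n : ∀ {n} → 3 ≤ n → StepBound (frac 154 100) 1ℚ n
n+154/100≤154/100*n {n} 3≤n = begin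
  1ℚ *ℚ r +ℚ a        ≤⟨ +-monoʳ-≤ (1ℚ *ℚ r) a≤b*r ⟩
  1ℚ *ℚ r +ℚ b *ℚ r   ≡⟨ *-distribʳ-+ r 1ℚ b ⟨
  (1ℚ +ℚ b) *ℚ r      ≡⟨⟩
  a *ℚ r              ∎
  where
  open ≤-Reasoning
  r = frac n 1
  a = frac 154 100
  b = frac 54 100
  a≤b*r : a ≤ℚ b *ℚ r
  a≤b*r = ≤-trans (≤ᵇ⇒≤ tt) (*-monoˡ-≤-nonNeg b (frac-monoˡ-≤ 1 3≤n))

d-outside-I : ∀ {n} → 25 ≤ n → d n ≡ 1ℚ
d-outside-I 25≤n = subst (λ n → d n ≡ 1ℚ) 25+k≡n refl
  where 25+k≡n = proj₂ (ℕ.m≤n⇒∃[o]m+o≡n 25≤n)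

d-bound : ∀ n → 2 ≤ n → StepBound (frac 154 100) (d n) n
d-bound n 2≤n = by-size (n <? 25)
  where
  d-bound-<25 : ∀ {n} → n < 25 → 2 ≤ n → StepBound (frac 154 100) (d n) n
  d-bound-<25 = toWitness {a? = allUpTo? (λ n → 2 ≤? n →-dec stepBound? (frac 154 100) (d n) n) 25} tt
  by-size : Dec (n < 25) → StepBound (frac 154 100) (d n) n
  by-size (yes n<25) = d-bound-<25 n<25 2≤n
  by-size (no n≮25)  = subst (λ δ → StepBound (frac 154 100) δ n) (sym (d-outside-I 25≤n))
    (n+154/100≤154/100*n (ℕ.≤-trans (ℕ.m≤n+m 3 22) 25≤n))
    where 25≤n = ℕ.≮⇒≥ n≮25

lemma4p8 : (m : ℕ) (c : Fin (suc m) → ℕ) (q : Fin m → ℕ) →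
    1 ≤ c zero →
    (∀ (j : Fin m) → c (inject₁ j) < c (suc j)) →
    (∀ (j : Fin m) → c (suc j) ≡ q j * c (inject₁ j)) →
    (∀ (j : Fin m) → 2 ≤ q j) →
    sumℚ (λ j → d (q j) *ℚ frac (c (fromℕ m)) (c (inject₁ j)))
    ≤ℚ frac 154 100 *ℚ frac (c (fromℕ m)) (c zero)
-- The strict increase of c is implied by the other hypotheses.
lemma4p8 m c q c₀≥1 _ = divisor-chain-sum-≤ d (frac 154 100) d-bound m c q c₀≥1
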